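{- If $G$ is a graph that is not complete, then $\mu(D(G))\ge n(G)+\mu_t(G)$. Moreover, the bound is sharp, i.e., there exist non-complete graphs $G$ for which equality holds.
   Context: All graphs are finite and simple; $n(G)$ is the order of $G$. The double graph $D(G)$ is obtained from the disjoint union of $G$ and a copy $G'$ with $V(G')=\{u': u\in V(G)\}$ by joining each $u\in V(G)$ to all neighbors of $u'$ in $G'$ and each $u'$ to all neighbors of $u$ in $G$; thus $N_{D(G)}(u)=N_{D(G)}(u')$. Given $S\subseteq V(H)$, two vertices $x,y$ of $H$ are $S$-visible if some shortest $x,y$-path in $H$ has no internal vertex in $S$. $S$ is a mutual-visibility set if every two vertices of $S$ are $S$-visible; $\mu(H)$ is the maximum size of such a set. $S$ is a total mutual-visibility set if every two vertices of $H$ (in $S$ or not) are $S$-visible; $\mu_t(H)$ is the maximum size of such a set. -}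

module Defs where

open import Data.Nat using (ℕ; zero; suc; _+_; _≤_)
open import Data.Fin using (Fin; splitAt)
open import Data.Fin.Subset using (Subset; _∈_; _∉_; ∣_∣)
open import Data.Sum using ([_,_]′)
open import Data.Product using (Σ; _×_; _,_)
open import Data.Unit using (⊤)
open import Relation.Nullary using (¬_)
open import Relation.Binary.PropositionalEquality using (_≡_; _≢_)
open import Function using (id; _∘_)

record Graph (n : ℕ) : Set₁ where
  field
    adj     : Fin n → Fin n → Set
    symm    : ∀ {x y} → adj x y → adj y x
    irrefl  : ∀ {x} → ¬ adj x x
open Graph public

-- order n(G) is the index n.

Complete : ∀ {n} → Graph n → Set
Complete {n} G = ∀ (x y : Fin n) → x ≢ y → adj G x y

data Walk {n} (G : Graph n) : Fin n → Fin n → Set where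
  [_] : (x : Fin n) → Walk G x x
  step : (x : Fin n) {y z : Fin n} → adj G x y → Walk G y z → Walk G x z

len : ∀ {n} {G : Graph n} {x y} → Walk G x y → ℕ
len [ x ] = 0
len (step x e w) = suc (len w)

-- A shortest x,y-path: a walk of minimum length among all x,y-walks
-- (a minimum-length walk is necessarily a path).
IsShortest : ∀ {n} {G : Graph n} {x y} → Walk G x y → Set
IsShortest {G = G} {x} {y} w = ∀ (w' : Walk G x y) → len w ≤ len w'

private
  avoidsTail : ∀ {n} {G : Graph n} {y z} → Subset n → Walk G y z → Set
  avoidsTail S [ y ] = ⊤
  avoidsTail S (step y e w) = (y ∉ S) × avoidsTail S w

InnerAvoids : ∀ {n} {G : Graph n} {x y} → Subset n → Walk G x y → Set
InnerAvoids S [ x ] = ⊤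
InnerAvoids S (step x e w) = avoidsTail S w

Visible : ∀ {n} → Graph n → Subset n → Fin n → Fin n → Set
Visible G S x y = Σ (Walk G x y) λ w → IsShortest w × InnerAvoids S w

IsMutualVisibilitySet : ∀ {n} → Graph n → Subset n → Set
IsMutualVisibilitySet G S = ∀ x y → x ∈ S → y ∈ S → Visible G S x y

IsTotalMutualVisibilitySet : ∀ {n} → Graph n → Subset n → Set
IsTotalMutualVisibilitySet G S = ∀ x y → Visible G S x y

IsMu : ∀ {n} → Graph n → ℕ → Set
IsMu {n} G k = Σ (Subset n) (λ S → IsMutualVisibilitySet G S × ∣ S ∣ ≡ k)
             × (∀ S → IsMutualVisibilitySet G S → ∣ S ∣ ≤ k)

IsMuT : ∀ {n} → Graph n → ℕ → Set
IsMuT {n} G k = Σ (Subset n) (λ S → IsTotalMutualVisibilitySet G S × ∣ S ∣ ≡ k)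
              × (∀ S → IsTotalMutualVisibilitySet G S → ∣ S ∣ ≤ k)

-- Double graph: vertices Fin (n + n); first block = V(G), second block = V(G').
-- orig maps u and u' to u. Adjacency: u~v, u'~v', u~v', u'~v iff uv ∈ E(G).
orig : ∀ {n} → Fin (n + n) → Fin n
orig {n} = [ id , id ]′ ∘ splitAt n

D : ∀ {n} → Graph n → Graph (n + n)
D G = record
  { adj = λ a b → adj G (orig a) (orig b)
  ; symm = symm G
  ; irrefl = irrefl G
  }

-- If S is a total mutual-visibility set of G, then S together with the whole
-- second copy V(G') is a mutual-visibility set of D(G).  Walks of D(G) project
-- to walks of G of the same length, so a shortest S-avoiding walk of G lifts,
-- with its interior in the first copy, to a shortest walk of D(G) avoiding the
-- set.  Distinct twins are non-adjacent, hence at distance two, and they are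
-- joined through any neighbour of their common original outside S; such a
-- neighbour exists because G is not complete.
-- Equality holds for the path P₃: when two vertices are non-adjacent the whole
-- vertex set is never a mutual-visibility set, so μ_t(P₃) = 2 and
-- μ(D(P₃)) = 5 = 3 + 2.
module Submission where

open import Defs
open import Data.Nat using (ℕ; suc; _+_; _≤_; _<_; z≤n; s≤s; s≤s⁻¹)
import Data.Nat.Properties as ℕ
open import Data.Fin using (Fin; zero; suc; toℕ; _↑ˡ_; _↑ʳ_; splitAt; _≟_)
open import Data.Fin.Properties using (splitAt-↑ˡ; splitAt⁻¹-↑ˡ; splitAt⁻¹-↑ʳ; any?)
open import Data.Fin.Subset using (Subset; inside; outside; ⊤; ∣_∣; _∈_; _∉_)
open import Data.Fin.Subset.Properties using (∈⊤; ∣⊤∣≡n; ∣p∣≤n; ∣p∣≡n⇒p≡⊤)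
open import Data.Vec using ([]; _∷_; _++_; there)
open import Data.Vec.Properties using (lookup-++ˡ; []=⇒lookup; lookup⇒[]=)
open import Data.Product using (Σ; ∃; ∃₂; _×_; _,_; proj₁; proj₂)
open import Data.Sum using (_⊎_; inj₁; inj₂; [_,_]′; swap)
open import Data.Unit using (tt)
open import Function using (_∘_)
open import Relation.Nullary using (¬_; Dec; yes; no; ¬?; _×-dec_; contradiction)
open import Relation.Nullary.Decidable using (decidable-stable)
open import Relation.Binary.PropositionalEquality
  using (_≡_; _≢_; refl; sym; trans; cong; cong₂; subst)

module _ {n : ℕ} (G : Graph n) where

  2≤len : ∀ {x y} → x ≢ y → ¬ adj G x y → (w : Walk G x y) → 2 ≤ len w
  2≤len x≢y _   [ _ ]                   = contradiction refl x≢y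
  2≤len _   x≁y (step _ x~y [ _ ])      = contradiction x~y x≁y
  2≤len _   _   (step _ _ (step _ _ _)) = s≤s (s≤s z≤n)

  visible-refl : ∀ S x → Visible G S x x
  visible-refl _ x = [ x ] , (λ _ → z≤n) , tt

  visible-edge : ∀ S {x y} → adj G x y → Visible G S x y
  visible-edge _ {x} {y} x~y = step x x~y [ y ] , 1≤len , tt
    where
    1≤len : (w : Walk G x y) → 1 ≤ len w
    1≤len [ _ ]        = contradiction x~y (irrefl G)
    1≤len (step _ _ _) = s≤s z≤n

  visible-via : ∀ S {x y} m → x ≢ y → ¬ adj G x y →
                adj G x m → adj G m y → m ∉ S → Visible G S x y
  visible-via _ {x} {y} m x≢y x≁y x~m m~y m∉S =
    step x x~m (step m m~y [ y ]) , 2≤len x≢y x≁y , m∉S , tt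

  visible⇒neighbour∉ : ∀ {S x y} → x ≢ y → ¬ adj G x y → Visible G S x y →
                       ∃ λ m → adj G x m × m ∉ S
  visible⇒neighbour∉ x≢y _   ([ _ ] , _)                             = contradiction refl x≢y
  visible⇒neighbour∉ _   x≁y (step _ x~y [ _ ] , _)                  = contradiction x~y x≁y
  visible⇒neighbour∉ _   _   (step _ x~m (step m _ _) , _ , m∉S , _) = m , x~m , m∉S

  ¬visible-⊤ : ∀ {x y} → x ≢ y → ¬ adj G x y → ¬ Visible G ⊤ x y
  ¬visible-⊤ x≢y x≁y visible with visible⇒neighbour∉ x≢y x≁y visible
  ... | _ , _ , m∉⊤ = m∉⊤ ∈⊤

  -- Adjacency is not assumed decidable, but a shortest walk between x and y decides it.
  adjacent? : (∀ x y → Σ (Walk G x y) IsShortest) → ∀ x y → Dec (adj G x y)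
  adjacent? shortest x y with x ≟ y | shortest x y
  ... | yes refl | _                    = no (irrefl G)
  ... | no x≢y   | [ _ ] , _            = contradiction refl x≢y
  ... | no _     | step _ x~y [ _ ] , _ = yes x~y
  ... | no _     | step _ _ (step _ _ _) , minimal =
    no λ x~y → contradiction (minimal (step x x~y [ y ])) λ { (s≤s ()) }

  module _ (adj? : ∀ x y → Dec (adj G x y)) where

    nonNeighbour? : ∀ u → Dec (∃ λ z → u ≢ z × ¬ adj G u z)
    nonNeighbour? u = any? λ z → ¬? (u ≟ z) ×-dec ¬? (adj? u z)

    ¬Complete⇒nonadjacent : ¬ Complete G → ∃₂ λ x y → x ≢ y × ¬ adj G x y
    ¬Complete⇒nonadjacent incomplete with any? nonNeighbour?
    ... | yes pair = pair
    ... | no none  = contradiction complete incomplete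
      where
      complete : Complete G
      complete x y x≢y = decidable-stable (adj? x y) λ x≁y → none (x , y , x≢y , x≁y)

module _ {n : ℕ} {G : Graph n} {S : Subset n} (total : IsTotalMutualVisibilitySet G S) where

  private
    adj? : ∀ x y → Dec (adj G x y)
    adj? = adjacent? G λ x y → proj₁ (total x y) , proj₁ (proj₂ (total x y))

  neighbour∉ : ¬ Complete G → ∀ u → u ∈ S → ∃ λ m → adj G u m × m ∉ S
  neighbour∉ incomplete u u∈S with nonNeighbour? G adj? u
  ... | yes (z , u≢z , u≁z) = visible⇒neighbour∉ G u≢z u≁z (total u z)
  -- Otherwise u is adjacent to every other vertex, in particular to the interior
  -- vertex outside S of a shortest walk between two non-adjacent vertices.
  ... | no none with ¬Complete⇒nonadjacent G adj? incomplete
  ... | x , y , x≢y , x≁y with visible⇒neighbour∉ G x≢y x≁y (total x y)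
  ... | m , _ , m∉S = m , u~m , m∉S
    where
    u~m : adj G u m
    u~m = decidable-stable (adj? u m) λ u≁m → none (m , (λ { refl → m∉S u∈S }) , u≁m)

∈-++⁻ˡ : ∀ {m k} {S : Subset m} (T : Subset k) {i} → i ↑ˡ k ∈ S ++ T → i ∈ S
∈-++⁻ˡ {S = S} T {i} i∈ = lookup⇒[]= i S (trans (sym (lookup-++ˡ S T i)) ([]=⇒lookup i∈))

∣++∣ : ∀ {m k} (S : Subset m) (T : Subset k) → ∣ S ++ T ∣ ≡ ∣ S ∣ + ∣ T ∣
∣++∣ []            T = refl
∣++∣ (inside ∷ S)  T = cong suc (∣++∣ S T)
∣++∣ (outside ∷ S) T = ∣++∣ S T

orig-↑ˡ : ∀ {n} (i : Fin n) → orig (i ↑ˡ n) ≡ i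
orig-↑ˡ {n} i rewrite splitAt-↑ˡ n i n = refl

copies : ∀ {n} (a : Fin (n + n)) → a ≡ orig a ↑ˡ n ⊎ a ≡ n ↑ʳ orig a
copies {n} a with splitAt n a in eq
... | inj₁ _ = inj₁ (sym (splitAt⁻¹-↑ˡ eq))
... | inj₂ _ = inj₂ (sym (splitAt⁻¹-↑ʳ eq))

distinct-twins⇒orig∈ : ∀ {n} {S : Subset n} {a b} → a ≢ b → orig a ≡ orig b →
                        a ∈ S ++ ⊤ → b ∈ S ++ ⊤ → orig a ∈ S
distinct-twins⇒orig∈ {n} {S} {a} {b} a≢b twins a∈ b∈ with copies a | copies b
... | inj₁ a≡ | _      = ∈-++⁻ˡ ⊤ (subst (_∈ S ++ ⊤) a≡ a∈)
... | inj₂ _  | inj₁ b≡ = subst (_∈ S) (sym twins) (∈-++⁻ˡ ⊤ (subst (_∈ S ++ ⊤) b≡ b∈))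
... | inj₂ a≡ | inj₂ b≡ = contradiction (trans a≡ (trans (cong (n ↑ʳ_) twins) (sym b≡))) a≢b

module _ {n : ℕ} (G : Graph n) where

  project : ∀ {a b} → Walk (D G) a b → Walk G (orig a) (orig b)
  project [ a ]          = [ orig a ]
  project (step a a~c w) = step (orig a) a~c (project w)

  len-project : ∀ {a b} (w : Walk (D G) a b) → len (project w) ≡ len w
  len-project [ _ ]        = refl
  len-project (step _ _ w) = cong suc (len-project w)

  ↑ˡ-adj : ∀ {y z} → adj G y z → adj G (orig (y ↑ˡ n)) z
  ↑ˡ-adj {y} {z} = subst (λ v → adj G v z) (sym (orig-↑ˡ y))

  -- Interior vertices are placed in the first copy.
  lift : ∀ a b {y v} → orig b ≡ v → adj G (orig a) y → Walk G y v → Walk (D G) a b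
  lift a b b↦v a~y [ _ ]          = step a (subst (adj G (orig a)) (sym b↦v) a~y) [ b ]
  lift a b b↦v a~y (step y y~z w) =
    step a (symm G (↑ˡ-adj (symm G a~y))) (lift (y ↑ˡ n) b b↦v (↑ˡ-adj y~z) w)

  len-lift : ∀ a b {y v} (b↦v : orig b ≡ v) (a~y : adj G (orig a) y) (w : Walk G y v) →
             len (lift a b b↦v a~y w) ≡ suc (len w)
  len-lift a b b↦v a~y [ _ ]          = refl
  len-lift a b b↦v a~y (step y y~z w) = cong suc (len-lift (y ↑ˡ n) b b↦v (↑ˡ-adj y~z) w)

  lift-avoids : ∀ {S : Subset n} (T : Subset n) a b {y v} (b↦v : orig b ≡ v)
                (a~y : adj G (orig a) y) (w : Walk G y v) →
                InnerAvoids S (step (orig a) a~y w) →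
                InnerAvoids (S ++ T) (lift a b b↦v a~y w)
  lift-avoids T a b b↦v a~y [ _ ]                         _              = tt
  lift-avoids T a b b↦v a~y (step y _ [ _ ])              (y∉S , _)      = y∉S ∘ ∈-++⁻ˡ T , tt
  lift-avoids T a b b↦v a~y (step y y~z (step z z~v w)) (y∉S , avoids) =
    y∉S ∘ ∈-++⁻ˡ T , lift-avoids T (y ↑ˡ n) b b↦v (↑ˡ-adj y~z) (step z z~v w) avoids

  lift-visible : ∀ {S u v} (T : Subset n) a b → u ≢ v → Visible G S u v →
                 orig a ≡ u → orig b ≡ v → Visible (D G) (S ++ T) a b
  lift-visible T a b u≢v ([ _ ] , _) _ _ = contradiction refl u≢v
  lift-visible T a b _ (step _ a~y w , minimal , avoids) refl refl =
    lift a b refl a~y w , lifted-minimal , lift-avoids T a b refl a~y w avoids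
    where
    open ℕ.≤-Reasoning
    lifted-minimal : IsShortest (lift a b refl a~y w)
    lifted-minimal w′ = begin
      len (lift a b refl a~y w)  ≡⟨ len-lift a b refl a~y w ⟩
      suc (len w)                ≤⟨ minimal (project w′) ⟩
      len (project w′)           ≡⟨ len-project w′ ⟩
      len w′                     ∎

  twins-visible : ∀ {S : Subset n} (T : Subset n) {a b} m → a ≢ b → orig a ≡ orig b →
                  adj G (orig a) m → m ∉ S → Visible (D G) (S ++ T) a b
  twins-visible T {a} m a≢b twins a~m m∉S =
    visible-via (D G) _ (m ↑ˡ n) a≢b (irrefl G ∘ subst (adj G (orig a)) (sym twins))
      (symm G (↑ˡ-adj (symm G a~m)))
      (subst (adj G _) twins (↑ˡ-adj (symm G a~m)))
      (m∉S ∘ ∈-++⁻ˡ T)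

S++⊤-isMutualVisibilitySet : ∀ {n} {G : Graph n} {S : Subset n} → ¬ Complete G →
                             IsTotalMutualVisibilitySet G S →
                             IsMutualVisibilitySet (D G) (S ++ ⊤)
S++⊤-isMutualVisibilitySet {G = G} incomplete total a b a∈ b∈ with orig a ≟ orig b
... | no origs≢ = lift-visible G ⊤ a b origs≢ (total (orig a) (orig b)) refl refl
... | yes twins with a ≟ b
...   | yes refl = visible-refl (D G) _ a
...   | no a≢b with neighbour∉ total incomplete (orig a) (distinct-twins⇒orig∈ a≢b twins a∈ b∈)
...     | m , a~m , m∉S = twins-visible G ⊤ m a≢b twins a~m m∉S

μ[D]≥n+μₜ : ∀ n (G : Graph n) → ¬ Complete G →
            ∀ k t → IsMu (D G) k → IsMuT G t → n + t ≤ k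
μ[D]≥n+μₜ n G incomplete k t (_ , maximal) ((S , total , ∣S∣≡t) , _) = begin
  n + t              ≡⟨ ℕ.+-comm n t ⟩
  t + n              ≡⟨ cong₂ _+_ (sym ∣S∣≡t) (sym (∣⊤∣≡n n)) ⟩
  ∣ S ∣ + ∣ ⊤ {n} ∣  ≡⟨ sym (∣++∣ S ⊤) ⟩
  ∣ S ++ ⊤ ∣         ≤⟨ maximal (S ++ ⊤) (S++⊤-isMutualVisibilitySet incomplete total) ⟩
  k                  ∎
  where open ℕ.≤-Reasoning

p≢⊤⇒∣p∣<n : ∀ {n} (p : Subset n) → p ≢ ⊤ → ∣ p ∣ < n
p≢⊤⇒∣p∣<n p p≢⊤ = ℕ.≤∧≢⇒< (∣p∣≤n p) (p≢⊤ ∘ ∣p∣≡n⇒p≡⊤)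

Path : (n : ℕ) → Graph n
Path n = record
  { adj    = λ i j → suc (toℕ i) ≡ toℕ j ⊎ suc (toℕ j) ≡ toℕ i
  ; symm   = swap
  ; irrefl = [ ℕ.1+n≢n , ℕ.1+n≢n ]′
  }

module P₃ where

  first middle last : Fin 3
  first  = zero
  middle = suc zero
  last   = suc (suc zero)

  first≁last : ¬ adj (Path 3) first last
  first≁last (inj₁ ())
  first≁last (inj₂ ())

  incomplete : ¬ Complete (Path 3)
  incomplete complete = first≁last (complete first last λ ())

  ends : Subset 3
  ends = inside ∷ outside ∷ inside ∷ []

  first↔last : ∀ {S} → middle ∉ S → Visible (Path 3) S first last
  first↔last = visible-via (Path 3) _ middle (λ ()) first≁last (inj₁ refl) (inj₁ refl)

  last↔first : ∀ {S} → middle ∉ S → Visible (Path 3) S last first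
  last↔first = visible-via (Path 3) _ middle (λ ()) (first≁last ∘ swap) (inj₂ refl) (inj₂ refl)

  ends-isTotal : IsTotalMutualVisibilitySet (Path 3) ends
  ends-isTotal zero             zero             = visible-refl (Path 3) ends first
  ends-isTotal zero             (suc zero)       = visible-edge (Path 3) ends (inj₁ refl)
  ends-isTotal zero             (suc (suc zero)) = first↔last λ { (there ()) }
  ends-isTotal (suc zero)       zero             = visible-edge (Path 3) ends (inj₂ refl)
  ends-isTotal (suc zero)       (suc zero)       = visible-refl (Path 3) ends middle
  ends-isTotal (suc zero)       (suc (suc zero)) = visible-edge (Path 3) ends (inj₁ refl)
  ends-isTotal (suc (suc zero)) zero             = last↔first λ { (there ()) }
  ends-isTotal (suc (suc zero)) (suc zero)       = visible-edge (Path 3) ends (inj₂ refl)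
  ends-isTotal (suc (suc zero)) (suc (suc zero)) = visible-refl (Path 3) ends last

  μₜ≡2 : IsMuT (Path 3) 2
  μₜ≡2 = (ends , ends-isTotal , refl) , λ S total →
    s≤s⁻¹ (p≢⊤⇒∣p∣<n S λ { refl → ¬visible-⊤ (Path 3) (λ ()) first≁last (total first last) })

  μ[D]≡5 : IsMu (D (Path 3)) 5
  μ[D]≡5 = (ends ++ ⊤ , S++⊤-isMutualVisibilitySet incomplete ends-isTotal , refl) , λ S mv →
    s≤s⁻¹ (p≢⊤⇒∣p∣<n S λ { refl →
      ¬visible-⊤ (D (Path 3)) (λ ()) first≁last (mv (first ↑ˡ 3) (last ↑ˡ 3) ∈⊤ ∈⊤) })

theorem3p2 : ((n : ℕ) (G : Graph n) → ¬ Complete G →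
                (k t : ℕ) → IsMu (D G) k → IsMuT G t → n + t ≤ k)
             × Σ ℕ (λ n → Σ (Graph n) (λ G → ¬ Complete G ×
                 Σ ℕ (λ k → Σ ℕ (λ t → IsMu (D G) k × IsMuT G t × k ≡ n + t))))
theorem3p2 = μ[D]≥n+μₜ , 3 , Path 3 , P₃.incomplete , 5 , 2 , P₃.μ[D]≡5 , P₃.μₜ≡2 , refl
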